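{- The SL sentence $\varphi^{grd}=\varphi^{ord}_\alpha\wedge\varphi^{ord}_\beta$ is satisfiable, where for $a\in\{\alpha,\beta\}$, $\varphi^{ord}_a=[\![z_1]\!]\langle\langle z_2\rangle\rangle\,z_1<_a z_2\ \wedge\ [\![z_1]\!][\![z_2]\!][\![z_3]\!]\,(z_1<_a z_2\wedge z_2<_a z_3)\rightarrow z_1<_a z_3$, with $x_1<_\alpha x_2:=\langle\langle y\rangle\rangle(\beta,y)\big((\alpha,x_1)(\mathsf{X}p)\wedge(\alpha,x_2)(\mathsf{X}\neg p)\big)$ and $y_1<_\beta y_2:=\langle\langle x\rangle\rangle(\alpha,x)\big((\beta,y_1)(\mathsf{X}\neg p)\wedge(\beta,y_2)(\mathsf{X}p)\big)$.
   Context: Agents are $\mathrm{Ag}=\{\alpha,\beta\}$ and $p$ is an atomic proposition. A concurrent game structure (CGS) $G=(\mathrm{AP},\mathrm{Ag},\mathrm{Ac},\mathrm{St},\lambda,\tau,s_0)$ has finite non-empty sets of atomic propositions and agents, countable non-empty sets of actions and states, initial state $s_0$, labeling $\lambda:\mathrm{St}\to2^{\mathrm{AP}}$ and transition function $\tau:\mathrm{St}\times\mathrm{Ac}^{\mathrm{Ag}}\to\mathrm{St}$. Strategies map tracks (finite histories of states) to actions. SL semantics: $\langle\langle y\rangle\rangle$/$[\![x]\!]$ quantify existentially/universally over strategies assigned to the variable; $(a,x)$ makes agent $a$ use the strategy of $x$; temporal operators ($\mathsf{X}$ = next) are evaluated as in LTL on the unique play once all agents are bound; $G\models\varphi$ iff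 $\varphi$ holds at $s_0$ under the empty assignment; a sentence is satisfiable if it has a model. -}

module Defs where

open import Data.Nat using (ℕ)
open import Data.Nat.Properties using (_≟_)
open import Data.Bool using (Bool; true; false; T)
open import Data.List using (List; []; _∷ʳ_)
open import Data.Maybe using (Maybe; just; nothing)
open import Data.Product using (Σ; _×_; _,_; ∃)
open import Data.Empty using (⊥)
open import Relation.Nullary using (¬_; yes; no)
open import Relation.Binary.PropositionalEquality using (_≡_)
open import Function.Definitions using (Injective)

data Agent : Set where
  α β : Agent

data AP : Set where
  p : AP

Countable : Set → Set
Countable A = Σ (A → ℕ) (λ f → Injective _≡_ _≡_ f)

-- Tracks: a non-empty finite history, given as (earlier states, current state)
Track : Set → Set
Track St = List St × St

extend : {St : Set} → Track St → St → Track St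
extend (ps , s) s' = (ps ∷ʳ s , s')

record CGS : Set₁ where
  field
    Ac       : Set
    St       : Set
    Ac-count : Countable Ac
    Ac-ne    : Ac
    St-count : Countable St
    lab      : St → AP → Bool
    τ        : St → (Agent → Ac) → St
    s₀       : St

Var : Set
Var = ℕ

data Formula : Set where
  atom  : AP → Formula
  ¬'_   : Formula → Formula
  _∧'_  : Formula → Formula → Formula
  _→'_  : Formula → Formula → Formula
  ⟪_⟫_  : Var → Formula → Formula
  ⟦_⟧_  : Var → Formula → Formula
  bind  : Agent → Var → Formula → Formula
  X     : Formula → Formula

infixr 5 _→'_
infixr 6 _∧'_
infix  7 ¬'_

module Semantics (G : CGS) where
  open CGS G

  Strategy : Set
  Strategy = Track St → Ac

  record Assignment : Set where
    field
      vars : Var → Maybe Strategy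
      agts : Agent → Maybe Strategy
  open Assignment

  empty : Assignment
  empty = record { vars = λ _ → nothing ; agts = λ _ → nothing }

  setVar : Assignment → Var → Strategy → Assignment
  setVar χ x σ = record χ { vars = λ y → case-eq y }
    where
      case-eq : Var → Maybe Strategy
      case-eq y with y ≟ x
      ... | yes _ = just σ
      ... | no _  = vars χ y

  agentEq : Agent → Agent → Bool
  agentEq α α = true
  agentEq β β = true
  agentEq _ _ = false

  setAgt : Assignment → Agent → Strategy → Assignment
  setAgt χ a σ = record χ { agts = λ b → sel (agentEq a b) b }
    where
      sel : Bool → Agent → Maybe Strategy
      sel true  _ = just σ
      sel false b = agts χ b

  next : Assignment → Track St → Maybe St
  next χ h@(_ , s) with agts χ α | agts χ β
  ... | just σα | just σβ = just (τ s (λ { α → σα h ; β → σβ h }))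
  ... | _ | _ = nothing

  _,_⊨_ : Assignment → Track St → Formula → Set
  χ , h ⊨ atom q    = T (lab (Data.Product.proj₂ h) q)
  χ , h ⊨ (¬' φ)    = ¬ (χ , h ⊨ φ)
  χ , h ⊨ (φ ∧' ψ)  = (χ , h ⊨ φ) × (χ , h ⊨ ψ)
  χ , h ⊨ (φ →' ψ)  = (χ , h ⊨ φ) → (χ , h ⊨ ψ)
  χ , h ⊨ (⟪ x ⟫ φ) = Σ Strategy (λ σ → setVar χ x σ , h ⊨ φ)
  χ , h ⊨ (⟦ x ⟧ φ) = (σ : Strategy) → setVar χ x σ , h ⊨ φ
  χ , h ⊨ bind a x φ with vars χ x
  ... | just σ  = setAgt χ a σ , h ⊨ φ
  ... | nothing = ⊥   -- unbound variable: does not occur in sentences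
  χ , h ⊨ X φ with next χ h
  ... | just s' = χ , extend h s' ⊨ φ
  ... | nothing = ⊥   -- some agent unbound: does not occur in sentences

_⊨_ : CGS → Formula → Set
G ⊨ φ = Semantics._,_⊨_ G (Semantics.empty G) ([] , CGS.s₀ G) φ

Satisfiable : Formula → Set₁
Satisfiable φ = Σ CGS (λ G → G ⊨ φ)

z₁ z₂ z₃ vy vx : Var
z₁ = 1
z₂ = 2
z₃ = 3
vy = 10
vx = 11

_<α_ : Var → Var → Formula
x₁ <α x₂ = ⟪ vy ⟫ bind β vy (bind α x₁ (X (atom p)) ∧' bind α x₂ (X (¬' atom p)))

_<β_ : Var → Var → Formula
y₁ <β y₂ = ⟪ vx ⟫ bind α vx (bind β y₁ (X (¬' atom p)) ∧' bind β y₂ (X (atom p)))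

lt : Agent → Var → Var → Formula
lt α = _<α_
lt β = _<β_

φ-ord : Agent → Formula
φ-ord a = (⟦ z₁ ⟧ ⟪ z₂ ⟫ lt a z₁ z₂)
       ∧' (⟦ z₁ ⟧ ⟦ z₂ ⟧ ⟦ z₃ ⟧ ((lt a z₁ z₂ ∧' lt a z₂ z₃) →' lt a z₁ z₃))

φ-grd : Formula
φ-grd = φ-ord α ∧' φ-ord β

-- In the model below an action is a natural number and the next state is labelled p
-- exactly when α's action is at most β's.  Comparing two strategies by the actions
-- they prescribe at the current track, z₁ <_α z₂ then says that β can answer so that
-- z₁ wins p while z₂ loses it, which happens iff z₁ plays a strictly smaller number;
-- dually for <_β.  Both relations are thus the strict order of ℕ pulled back along
-- evaluation at the current track, which has no maximum and is transitive.
module Submission where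

open import Defs hiding (_⊨_)
open import Data.Nat using (ℕ; suc; _≤ᵇ_; _<_)
open import Data.Nat.Properties
  using (_≟_; ≤ᵇ⇒≤; ≤⇒≤ᵇ; ≤-refl; <⇒≱; ≰⇒>; n<1+n; ≤-<-trans; <-≤-trans; <-trans)
open import Data.Bool using (Bool; true; false)
open import Data.List using ([])
open import Data.Maybe using (just)
open import Data.Product using (_,_)
open import Data.Empty using (⊥-elim)
open import Function using (id; _∘_)
open import Function.Construct.Composition using (_⇔-∘_)
open import Function.Bundles using (_⇔_; mk⇔; Equivalence)
open import Function.Definitions using (Injective)
open import Relation.Nullary using (yes; no)
open import Relation.Binary.PropositionalEquality using (_≡_; _≢_; refl; trans)

boolToℕ : Bool → ℕ
boolToℕ false = 0
boolToℕ true  = 1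

boolToℕ-injective : Injective _≡_ _≡_ boolToℕ
boolToℕ-injective {false} {false} _ = refl
boolToℕ-injective {true}  {true}  _ = refl

orderGame : CGS
orderGame = record
  { Ac       = ℕ
  ; St       = Bool
  ; Ac-count = id , id
  ; Ac-ne    = 0
  ; St-count = boolToℕ , boolToℕ-injective
  ; lab      = λ s _ → s
  ; τ        = λ _ act → act α ≤ᵇ act β
  ; s₀       = true
  }

module _ {G : CGS} where
  open Semantics G
  open Assignment

  vars-setVar-≢ : ∀ χ {x y} σ → y ≢ x → vars (setVar χ x σ) y ≡ vars χ y
  vars-setVar-≢ χ {x} {y} σ y≢x with y ≟ x
  ... | yes y≡x = ⊥-elim (y≢x y≡x)
  ... | no _    = refl

  ⊨bind⇔ : ∀ {χ h a x φ σ} → vars χ x ≡ just σ → (χ , h ⊨ bind a x φ) ⇔ (setAgt χ a σ , h ⊨ φ)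
  ⊨bind⇔ {χ} {x = x} eq with vars χ x | eq
  ... | just _ | refl = mk⇔ id id

open Semantics orderGame
open Assignment

⊨X⇔ : ∀ {χ h φ σα σβ} → agts χ α ≡ just σα → agts χ β ≡ just σβ →
      (χ , h ⊨ X φ) ⇔ (χ , extend h (σα h ≤ᵇ σβ h) ⊨ φ)
⊨X⇔ {χ} eqα eqβ with agts χ α | agts χ β | eqα | eqβ
... | just _ | just _ | refl | refl = mk⇔ id id

module _ {χ : Assignment} {h : Track Bool} {x₁ x₂ : Var} {σ₁ σ₂ : Strategy}
         (x₁↦σ₁ : vars χ x₁ ≡ just σ₁) (x₂↦σ₂ : vars χ x₂ ≡ just σ₂) where

  ⊨<α⇔< : x₁ ≢ vy → x₂ ≢ vy → (χ , h ⊨ (x₁ <α x₂)) ⇔ σ₁ h < σ₂ h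
  ⊨<α⇔< x₁≢vy x₂≢vy = mk⇔ to from
    where
    bindα : ∀ {x σ} c φ → x ≢ vy → vars χ x ≡ just σ →
            (setAgt (setVar χ vy c) β c , h ⊨ bind α x (X φ)) ⇔
            (setAgt (setAgt (setVar χ vy c) β c) α σ , extend h (σ h ≤ᵇ c h) ⊨ φ)
    bindα {x} c φ x≢vy x↦σ =
      ⊨X⇔ {h = h} {φ = φ} refl refl
        ⇔-∘ ⊨bind⇔ {χ = setAgt (setVar χ vy c) β c} {h = h} {a = α} {x = x} {φ = X φ}
                   (trans (vars-setVar-≢ χ c x≢vy) x↦σ)

    to : χ , h ⊨ (x₁ <α x₂) → σ₁ h < σ₂ h
    to (c , wins , loses) =
      ≤-<-trans (≤ᵇ⇒≤ _ _ (Equivalence.to (bindα c _ x₁≢vy x₁↦σ₁) wins))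
                (≰⇒> (Equivalence.to (bindα c _ x₂≢vy x₂↦σ₂) loses ∘ ≤⇒≤ᵇ))
    from : σ₁ h < σ₂ h → χ , h ⊨ (x₁ <α x₂)
    from σ₁<σ₂ = σ₁ , Equivalence.from (bindα σ₁ _ x₁≢vy x₁↦σ₁) (≤⇒≤ᵇ (≤-refl {σ₁ h}))
                    , Equivalence.from (bindα σ₁ _ x₂≢vy x₂↦σ₂) (<⇒≱ σ₁<σ₂ ∘ ≤ᵇ⇒≤ _ _)

  ⊨<β⇔< : x₁ ≢ vx → x₂ ≢ vx → (χ , h ⊨ (x₁ <β x₂)) ⇔ σ₁ h < σ₂ h
  ⊨<β⇔< x₁≢vx x₂≢vx = mk⇔ to from
    where
    bindβ : ∀ {x σ} c φ → x ≢ vx → vars χ x ≡ just σ →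
            (setAgt (setVar χ vx c) α c , h ⊨ bind β x (X φ)) ⇔
            (setAgt (setAgt (setVar χ vx c) α c) β σ , extend h (c h ≤ᵇ σ h) ⊨ φ)
    bindβ {x} c φ x≢vx x↦σ =
      ⊨X⇔ {h = h} {φ = φ} refl refl
        ⇔-∘ ⊨bind⇔ {χ = setAgt (setVar χ vx c) α c} {h = h} {a = β} {x = x} {φ = X φ}
                   (trans (vars-setVar-≢ χ c x≢vx) x↦σ)

    to : χ , h ⊨ (x₁ <β x₂) → σ₁ h < σ₂ h
    to (c , loses , wins) =
      <-≤-trans {j = c h} (≰⇒> (Equivalence.to (bindβ c _ x₁≢vx x₁↦σ₁) loses ∘ ≤⇒≤ᵇ))
                (≤ᵇ⇒≤ _ _ (Equivalence.to (bindβ c _ x₂≢vx x₂↦σ₂) wins))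
    from : σ₁ h < σ₂ h → χ , h ⊨ (x₁ <β x₂)
    from σ₁<σ₂ = σ₂ , Equivalence.from (bindβ σ₂ _ x₁≢vx x₁↦σ₁) (<⇒≱ σ₁<σ₂ ∘ ≤ᵇ⇒≤ _ _)
                    , Equivalence.from (bindβ σ₂ _ x₂≢vx x₂↦σ₂) (≤⇒≤ᵇ (≤-refl {σ₂ h}))

  ⊨lt⇔< : ∀ a → x₁ ≢ vx → x₁ ≢ vy → x₂ ≢ vx → x₂ ≢ vy → (χ , h ⊨ lt a x₁ x₂) ⇔ σ₁ h < σ₂ h
  ⊨lt⇔< α _      x₁≢vy _      x₂≢vy = ⊨<α⇔< x₁≢vy x₂≢vy
  ⊨lt⇔< β x₁≢vx _      x₂≢vx _      = ⊨<β⇔< x₁≢vx x₂≢vx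

⊨φ-ord : ∀ a χ h → χ , h ⊨ φ-ord a
⊨φ-ord a χ h = unbounded , transitive
  where
  unbounded : χ , h ⊨ (⟦ z₁ ⟧ ⟪ z₂ ⟫ lt a z₁ z₂)
  unbounded σ₁ = (λ _ → suc (σ₁ h))
               , Equivalence.from (⊨lt⇔< refl refl a (λ ()) (λ ()) (λ ()) (λ ())) (n<1+n (σ₁ h))

  transitive : χ , h ⊨ (⟦ z₁ ⟧ ⟦ z₂ ⟧ ⟦ z₃ ⟧ ((lt a z₁ z₂ ∧' lt a z₂ z₃) →' lt a z₁ z₃))
  transitive σ₁ σ₂ σ₃ (z₁<z₂ , z₂<z₃) =
    Equivalence.from (⊨lt⇔< refl refl a (λ ()) (λ ()) (λ ()) (λ ()))
      (<-trans (Equivalence.to (⊨lt⇔< refl refl a (λ ()) (λ ()) (λ ()) (λ ())) z₁<z₂)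
               (Equivalence.to (⊨lt⇔< refl refl a (λ ()) (λ ()) (λ ()) (λ ())) z₂<z₃))

lemma3p7 : Satisfiable φ-grd
lemma3p7 = orderGame , ⊨φ-ord α empty root , ⊨φ-ord β empty root
  where
  root : Track Bool
  root = [] , true
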